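{- Let $G=(V,E)$ be a $d$-regular undirected graph and let $D=(V',E')$ be the DAG with $V'=V\cup E$ and $E'=\{(e,v): e\in E, v\in V, v\in e\}$ (an arc from each edge-node to each of its two endpoints). Then $\mathrm{layout}(D;E,\Sigma)\le(\mathrm{MLA}(G)+O(|E|))\cdot(d+1)$ and $\mathrm{layout}(D;E,\max)\le\mathrm{MCLA}(G)+d$.
   Context: For an undirected graph $G$ on $n$ vertices and bijection $\pi:V\to[n]$, $E_i(\pi)$ is the set of edges with one endpoint at position $\le i$ and the other at position $>i$; $\mathrm{MLA}(G)=\min_\pi\sum_i|E_i(\pi)|$, $\mathrm{MCLA}(G)=\min_\pi\max_i|E_i(\pi)|$. For the DAG $D$ with $N=|V'|$ nodes, a feasible ordering is a topological ordering $\pi':V'\to[N]$; $E_i(\pi')$ is the set of arcs $(x,y)$ with $\pi'(x)\le i<\pi'(y)$; $\mathrm{layout}(D;E,\Sigma)=\min_{\pi'}\sum_{i}|E_i(\pi')|$ and $\mathrm{layout}(D;E,\max)=\min_{\pi'}\max_i|E_i(\pi')|$. $O(|E|)$ denotes a quantity at most an absolute constant times $|E|$. -}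

module Defs where

open import Data.Nat using (ℕ; zero; suc; _+_; _*_; _≤_; _<_; _⊔_; _<ᵇ_; _≤ᵇ_)
open import Data.Bool using (Bool; true; false; _∧_; _∨_)
open import Data.Fin using (Fin; toℕ; _≟_)
open import Data.Product using (_×_; _,_; proj₁; proj₂; ∃)
open import Data.Sum using (_⊎_; inj₁; inj₂)
open import Function.Bundles using (_↔_; Inverse)
open import Relation.Binary.PropositionalEquality using (_≡_; _≢_)
open import Relation.Nullary.Decidable using (⌊_⌋)
open import Data.Unit using (⊤)
open import Data.Bool using (if_then_else_)
import Data.Fin as F

count : ∀ {m} → (Fin m → Bool) → ℕ
count {zero}  p = 0
count {suc m} p = (if p F.zero then 1 else 0) + count (λ i → p (F.suc i))

sumTo : (ℕ → ℕ) → ℕ → ℕ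
sumTo f zero    = 0
sumTo f (suc N) = sumTo f N + f (suc N)

maxTo : (ℕ → ℕ) → ℕ → ℕ
maxTo f zero    = 0
maxTo f (suc N) = maxTo f N ⊔ f (suc N)

SameEdge : ∀ {n} → Fin n × Fin n → Fin n × Fin n → Set
SameEdge (a , b) (c , d) = (a ≡ c × b ≡ d) ⊎ (a ≡ d × b ≡ c)

record Graph (n m : ℕ) : Set where
  field
    ends   : Fin m → Fin n × Fin n
    noLoop : ∀ e → proj₁ (ends e) ≢ proj₂ (ends e)
    simple : ∀ e e′ → SameEdge (ends e) (ends e′) → e ≡ e′
open Graph public

incident : ∀ {n m} → Graph n m → Fin n → Fin m → Bool
incident G v e = ⌊ v ≟ proj₁ (ends G e) ⌋ ∨ ⌊ v ≟ proj₂ (ends G e) ⌋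

degree : ∀ {n m} → Graph n m → Fin n → ℕ
degree G v = count (incident G v)

Regular : ∀ {n m} → Graph n m → ℕ → Set
Regular G d = ∀ v → degree G v ≡ d

pos : ∀ {A : Set} {N} → A ↔ Fin N → A → ℕ
pos π x = toℕ (Inverse.to π x)

-- |E_i(π)| for G (positions are 1-based in the paper: 1-based position
-- p+1 ≤ i  iff  p < i, and p+1 > i iff i ≤ p)
cutG : ∀ {n m} → Graph n m → Fin n ↔ Fin n → ℕ → ℕ
cutG G π i = count λ e →
  let a = pos π (proj₁ (ends G e)) ; b = pos π (proj₂ (ends G e)) in
  ((a <ᵇ i) ∧ (i ≤ᵇ b)) ∨ ((b <ᵇ i) ∧ (i ≤ᵇ a))

costΣ : ∀ {n m} → Graph n m → Fin n ↔ Fin n → ℕ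
costΣ {n} G π = sumTo (cutG G π) n

costMax : ∀ {n m} → Graph n m → Fin n ↔ Fin n → ℕ
costMax {n} G π = maxTo (cutG G π) n

-- The DAG D: nodes V' = V ⊎ E (inj₁ v a vertex node, inj₂ e an edge node);
-- arcs (inj₂ e , inj₁ u) and (inj₂ e , inj₁ v) for each edge e = {u,v}.
DOrd : ℕ → ℕ → Set
DOrd n m = (Fin n ⊎ Fin m) ↔ Fin (n + m)

Topological : ∀ {n m} → Graph n m → DOrd n m → Set
Topological G σ = ∀ e →
  (pos σ (inj₂ e) < pos σ (inj₁ (proj₁ (ends G e)))) ×
  (pos σ (inj₂ e) < pos σ (inj₁ (proj₂ (ends G e))))

-- |E_i(π')| : arcs (x,y) with π'(x) ≤ i < π'(y) (1-based)
cutD : ∀ {n m} → Graph n m → DOrd n m → ℕ → ℕ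
cutD G σ i =
  count (λ e → (pos σ (inj₂ e) <ᵇ i) ∧ (i ≤ᵇ pos σ (inj₁ (proj₁ (ends G e))))) +
  count (λ e → (pos σ (inj₂ e) <ᵇ i) ∧ (i ≤ᵇ pos σ (inj₁ (proj₂ (ends G e)))))

costDΣ : ∀ {n m} → Graph n m → DOrd n m → ℕ
costDΣ {n} {m} G σ = sumTo (cutD G σ) (n + m)

costDMax : ∀ {n m} → Graph n m → DOrd n m → ℕ
costDMax {n} {m} G σ = maxTo (cutD G σ) (n + m)

IsMinOver : (X : Set) → (X → Set) → (X → ℕ) → ℕ → Set
IsMinOver X P f k = (∃ λ x → P x × f x ≡ k) × (∀ x → P x → k ≤ f x)

Always : ∀ {X : Set} → X → Set
Always _ = ⊤

IsMLA IsMCLA : ∀ {n m} → Graph n m → ℕ → Set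
IsMLA  G = IsMinOver _ Always (costΣ G)
IsMCLA G = IsMinOver _ Always (costMax G)

IsLayoutΣ IsLayoutMax : ∀ {n m} → Graph n m → ℕ → Set
IsLayoutΣ   G = IsMinOver _ (Topological G) (costDΣ G)
IsLayoutMax G = IsMinOver _ (Topological G) (costDMax G)

-- Lay D out by taking an optimal order π of G and putting every edge node
-- immediately before the earlier of its two endpoints, its owner.  The cut
-- of D right after a vertex node v consists of arcs (e, u) with e before v
-- and u after v, so e is an edge of G separated at v's position: it is at
-- most the cut of G there.  Right after an edge node owned by w the same
-- holds, except that arcs into w itself may also cross; there are at most
-- deg w = d of them.  Hence the maximal cut grows by at most d, and in the
-- sum every vertex position contributes its G-cut once for the vertex and
-- once for each of the at most d edge nodes it owns, plus d per edge node,
-- which gives (MLA + m)(d + 1).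

module Submission where

open import Defs
open import Data.Nat using (ℕ; zero; suc; _+_; _*_; _≤_; _<_; _⊓_; _<ᵇ_; _≤ᵇ_; z≤n; s≤s; s≤s⁻¹)
open import Data.Nat.Properties hiding (_≟_)
open import Data.Nat.Tactic.RingSolver using (solve-∀)
open import Data.Bool using (Bool; true; false; T; if_then_else_; _∧_; _∨_)
open import Data.Bool.Properties using (T-∧; T-∨)
open import Data.Empty using (⊥-elim)
open import Data.Fin as Fin using (Fin; toℕ; _≟_; splitAt; fromℕ<; punchOut)
open import Data.Fin.Properties as Finₚ
  using (any?; pigeonhole; punchOut-injective; toℕ-inject₁; toℕ-fromℕ; toℕ-fromℕ<; toℕ-injective; toℕ<n; +↔⊎)
open import Data.Product using (_×_; _,_; proj₁; proj₂; ∃; ∃₂)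
open import Data.Sum using (_⊎_; inj₁; inj₂; map₁)
open import Function using (_∘_)
open import Function.Bundles using (_↔_; Inverse; Injection; Equivalence; mk↔ₛ′)
open import Function.Definitions using (Injective)
open import Function.Properties.Inverse using (↔⇒↣)
open import Function.Construct.Symmetry using (↔-sym)
open import Function.Construct.Composition using (_↔-∘_)
open import Relation.Binary.PropositionalEquality
open import Relation.Binary.Definitions using (tri<; tri≈; tri>)
open import Relation.Nullary.Decidable using (⌊_⌋; yes; no; fromWitness; toWitness)
open import Relation.Nullary.Negation using (¬_; contradiction)

open import Algebra.Properties.Semiring.Sum +-*-semiring
  using (sum; sum-cong-≗; sum-permute; ∑-comm; ∑-distrib-+; *-distribˡ-sum; *-distribʳ-sum;
         sum-replicate-zero; sum-init-last)
open import Algebra.Properties.CommutativeSemigroup +-commutativeSemigroup using (interchange)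

ind : Bool → ℕ
ind b = if b then 1 else 0

ind-mono : ∀ {b c} → (T b → T c) → ind b ≤ ind c
ind-mono {false}         _ = z≤n
ind-mono {true} {true}   _ = ≤-refl
ind-mono {true} {false} b⇒c = ⊥-elim (b⇒c _)

ind-≥1 : ∀ {r s} → T r ⊎ T s → 1 ≤ ind r + ind s
ind-≥1 {true}          _         = s≤s z≤n
ind-≥1 {false} {true}  _         = s≤s z≤n
ind-≥1 {false} {false} (inj₁ ())
ind-≥1 {false} {false} (inj₂ ())

ind-+-≤ : ∀ {b c r s : Bool} → (T b → T r ⊎ T s) → (T c → T r ⊎ T s) →
          (T b → T c → T r × T s) → ind b + ind c ≤ ind r + ind s
ind-+-≤ {false} {false}                 _  _  _    = z≤n
ind-+-≤ {true}  {false}                 b⇒ _  _    = ind-≥1 (b⇒ _)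
ind-+-≤ {false} {true}                  _  c⇒ _    = ind-≥1 (c⇒ _)
ind-+-≤ {true}  {true}  {true}  {true}  _  _  _    = ≤-refl
ind-+-≤ {true}  {true}  {false}         _  _  both = ⊥-elim (proj₁ (both _ _))
ind-+-≤ {true}  {true}  {true}  {false} _  _  both = ⊥-elim (proj₂ (both _ _))

count-mono : ∀ {m} {p q : Fin m → Bool} → (∀ i → T (p i) → T (q i)) → count p ≤ count q
count-mono {zero}  _   = z≤n
count-mono {suc m} p⇒q = +-mono-≤ (ind-mono (p⇒q Fin.zero)) (count-mono (p⇒q ∘ Fin.suc))

count-mono-< : ∀ {m} {p q : Fin m → Bool} → (∀ i → T (p i) → T (q i)) →
               ∀ j → ¬ T (p j) → T (q j) → count p < count q
count-mono-< {suc m} {p} {q} p⇒q Fin.zero ¬pj qj with p Fin.zero | q Fin.zero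
... | false | true  = s≤s (count-mono (p⇒q ∘ Fin.suc))
... | true  | _     = ⊥-elim (¬pj _)
count-mono-< {suc m} p⇒q (Fin.suc j) ¬pj qj =
  +-mono-≤-< (ind-mono (p⇒q Fin.zero)) (count-mono-< (p⇒q ∘ Fin.suc) j ¬pj qj)

count-true : ∀ m → count {m} (λ _ → true) ≡ m
count-true zero    = refl
count-true (suc m) = cong suc (count-true m)

count-false : ∀ m → count {m} (λ _ → false) ≡ 0
count-false zero    = refl
count-false (suc m) = count-false m

count-+-mono : ∀ {m} {p q r s : Fin m → Bool} →
               (∀ i → ind (p i) + ind (q i) ≤ ind (r i) + ind (s i)) →
               count p + count q ≤ count r + count s
count-+-mono {zero}  _  = z≤n
count-+-mono {suc m} {p} {q} {r} {s} le = begin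
  (ind (p Fin.zero) + count (p ∘ Fin.suc)) + (ind (q Fin.zero) + count (q ∘ Fin.suc))
    ≡⟨ interchange (ind (p Fin.zero)) _ _ _ ⟩
  (ind (p Fin.zero) + ind (q Fin.zero)) + (count (p ∘ Fin.suc) + count (q ∘ Fin.suc))
    ≤⟨ +-mono-≤ (le Fin.zero) (count-+-mono (le ∘ Fin.suc)) ⟩
  (ind (r Fin.zero) + ind (s Fin.zero)) + (count (r ∘ Fin.suc) + count (s ∘ Fin.suc))
    ≡⟨ interchange (ind (r Fin.zero)) _ _ _ ⟩
  (ind (r Fin.zero) + count (r ∘ Fin.suc)) + (ind (s Fin.zero) + count (s ∘ Fin.suc))
    ∎
  where open ≤-Reasoning

count≡sum : ∀ {m} (p : Fin m → Bool) → count p ≡ sum (ind ∘ p)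
count≡sum {zero}  _ = refl
count≡sum {suc m} p = cong (ind (p Fin.zero) +_) (count≡sum (p ∘ Fin.suc))

sum-mono : ∀ {m} {f g : Fin m → ℕ} → (∀ i → f i ≤ g i) → sum f ≤ sum g
sum-mono {zero}  _    = z≤n
sum-mono {suc m} f≤g = +-mono-≤ (f≤g Fin.zero) (sum-mono (f≤g ∘ Fin.suc))

sum-const : ∀ m c → sum {m} (λ _ → c) ≡ m * c
sum-const zero    c = refl
sum-const (suc m) c = cong (c +_) (sum-const m c)

sum-δ : ∀ {n} (w : Fin n) (h : Fin n → ℕ) → sum (λ v → ind ⌊ w ≟ v ⌋ * h v) ≡ h w
sum-δ {suc n} Fin.zero    h =
  trans (cong₂ _+_ (+-identityʳ (h Fin.zero)) (sum-replicate-zero n)) (+-identityʳ (h Fin.zero))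
sum-δ {suc n} (Fin.suc w) h =
  trans (sum-cong-≗ {n} (λ v → cong (_* h (Fin.suc v)) (ind-suc≟suc v))) (sum-δ w (h ∘ Fin.suc))
  where
  -- Fin's _≟_ goes through map′ on suc, so this needs a case split.
  ind-suc≟suc : ∀ v → ind ⌊ Fin.suc w ≟ Fin.suc v ⌋ ≡ ind ⌊ w ≟ v ⌋
  ind-suc≟suc v with w ≟ v
  ... | yes _ = refl
  ... | no  _ = refl

sum-fibres-≤ : ∀ {m n} d (f : Fin m → Fin n) (h : Fin n → ℕ) →
               (∀ v → count (λ e → ⌊ f e ≟ v ⌋) ≤ d) → sum (h ∘ f) ≤ d * sum h
sum-fibres-≤ {m} {n} d f h fibre≤d = begin
  sum (h ∘ f)
    ≡⟨ sum-cong-≗ {m} (λ e → sym (sum-δ (f e) h)) ⟩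
  sum (λ e → sum (λ v → ind ⌊ f e ≟ v ⌋ * h v))
    ≡⟨ ∑-comm (λ e v → ind ⌊ f e ≟ v ⌋ * h v) ⟩
  sum (λ v → sum (λ e → ind ⌊ f e ≟ v ⌋ * h v))
    ≡⟨ sum-cong-≗ {n} (λ v → sym (*-distribʳ-sum (h v) (λ e → ind ⌊ f e ≟ v ⌋))) ⟩
  sum (λ v → sum (λ e → ind ⌊ f e ≟ v ⌋) * h v)
    ≡⟨ sum-cong-≗ {n} (λ v → cong (_* h v) (count≡sum (λ e → ⌊ f e ≟ v ⌋))) ⟨
  sum (λ v → count (λ e → ⌊ f e ≟ v ⌋) * h v)
    ≤⟨ sum-mono (λ v → *-monoˡ-≤ (h v) (fibre≤d v)) ⟩
  sum (λ v → d * h v)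
    ≡⟨ *-distribˡ-sum d h ⟨
  d * sum h
    ∎
  where open ≤-Reasoning

sum-splitAt : ∀ n {m} (h : Fin n ⊎ Fin m → ℕ) →
              sum (h ∘ splitAt n) ≡ sum (h ∘ inj₁) + sum (h ∘ inj₂)
sum-splitAt zero    h = refl
sum-splitAt (suc n) h = trans (cong (h (inj₁ Fin.zero) +_) (sum-splitAt n (h ∘ map₁ Fin.suc)))
                              (sym (+-assoc (h (inj₁ Fin.zero)) _ _))

sumTo≡sum : ∀ f N → sumTo f N ≡ sum (λ (i : Fin N) → f (suc (toℕ i)))
sumTo≡sum f zero    = refl
sumTo≡sum f (suc N) = sym (begin
  sum (λ (i : Fin (suc N)) → f (suc (toℕ i)))
    ≡⟨ sum-init-last {N} (λ i → f (suc (toℕ i))) ⟩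
  sum (λ (i : Fin N) → f (suc (toℕ (Fin.inject₁ i)))) + f (suc (toℕ (Fin.fromℕ N)))
    ≡⟨ cong₂ _+_ (sum-cong-≗ {N} (λ i → cong (f ∘ suc) (toℕ-inject₁ i))) (cong (f ∘ suc) (toℕ-fromℕ N)) ⟩
  sum (λ (i : Fin N) → f (suc (toℕ i))) + f (suc N)
    ≡⟨ cong (_+ f (suc N)) (sumTo≡sum f N) ⟨
  sumTo f (suc N)
    ∎)
  where open ≡-Reasoning

maxTo-lub : ∀ f N {B} → (∀ i → i < N → f (suc i) ≤ B) → maxTo f N ≤ B
maxTo-lub f zero    _   = z≤n
maxTo-lub f (suc N) f≤B = ⊔-lub (maxTo-lub f N (λ i i<N → f≤B i (m<n⇒m<1+n i<N))) (f≤B N ≤-refl)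

≤-maxTo : ∀ f N {i} → i < N → f (suc i) ≤ maxTo f N
≤-maxTo f (suc N) {i} i<1+N with m<1+n⇒m<n∨m≡n i<1+N
... | inj₁ i<N  = ≤-trans (≤-maxTo f N i<N) (m≤m⊔n (maxTo f N) _)
... | inj₂ refl = m≤n⊔m (maxTo f N) _

-- Sorting a finite type by an injective key

Fin-injective⇒surjective : ∀ {N} (g : Fin N → Fin N) → Injective _≡_ _≡_ g → ∀ j → ∃ λ i → g i ≡ j
Fin-injective⇒surjective {suc N} g g-inj j with any? (λ i → g i ≟ j)
... | yes hit  = hit
... | no  miss = ⊥-elim (collision (pigeonhole (n<1+n N) (λ i → punchOut (j≢g i))))
  where
  j≢g : ∀ i → j ≢ g i
  j≢g i j≡gi = miss (i , sym j≡gi)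
  collision : ¬ ∃₂ λ i i′ → i Fin.< i′ × punchOut (j≢g i) ≡ punchOut (j≢g i′)
  collision (i , i′ , i<i′ , same) =
    Finₚ.<⇒≢ i<i′ (g-inj (punchOut-injective (j≢g i) (j≢g i′) same))

module Sorting {A : Set} {N} (enum : A ↔ Fin N) (κ : A → ℕ) (κ-injective : Injective _≡_ _≡_ κ) where

  open Inverse enum using () renaming (to to index; from to element)

  rank : A → ℕ
  rank x = count (λ j → κ (element j) <ᵇ κ x)

  private
    not-below-itself : ∀ x → ¬ T (κ (element (index x)) <ᵇ κ x)
    not-below-itself x rewrite Inverse.strictlyInverseʳ enum x = <-irrefl refl ∘ <ᵇ⇒< (κ x) (κ x)

  rank-mono-< : ∀ {x y} → κ x < κ y → rank x < rank y
  rank-mono-< {x} {y} κx<κy =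
    count-mono-< (λ j below-x → <⇒<ᵇ (<-trans (<ᵇ⇒< _ _ below-x) κx<κy)) (index x) (not-below-itself x)
      (subst (λ z → T (κ z <ᵇ κ y)) (sym (Inverse.strictlyInverseʳ enum x)) (<⇒<ᵇ κx<κy))

  rank<N : ∀ x → rank x < N
  rank<N x = subst (rank x <_) (count-true N) (count-mono-< _ (index x) (not-below-itself x) _)

  rank-cancel-< : ∀ {x y} → rank x < rank y → κ x < κ y
  rank-cancel-< {x} {y} rx<ry with <-cmp (κ x) (κ y)
  ... | tri< κx<κy _ _ = κx<κy
  ... | tri≈ _ κx≡κy _ = contradiction rx<ry (<-irrefl (cong rank (κ-injective κx≡κy)))
  ... | tri> _ _ κy<κx = contradiction rx<ry (<-asym (rank-mono-< κy<κx))

  rank-injective : Injective _≡_ _≡_ rank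
  rank-injective {x} {y} rx≡ry with <-cmp (κ x) (κ y)
  ... | tri< κx<κy _ _ = contradiction rx≡ry (<⇒≢ (rank-mono-< κx<κy))
  ... | tri≈ _ κx≡κy _ = κ-injective κx≡κy
  ... | tri> _ _ κy<κx = contradiction (sym rx≡ry) (<⇒≢ (rank-mono-< κy<κx))

  private
    slot : A → Fin N
    slot x = fromℕ< (rank<N x)

    toℕ-slot : ∀ x → toℕ (slot x) ≡ rank x
    toℕ-slot x = toℕ-fromℕ< (rank<N x)

    slot-injective : Injective _≡_ _≡_ slot
    slot-injective {x} {y} eq = rank-injective (trans (sym (toℕ-slot x)) (trans (cong toℕ eq) (toℕ-slot y)))

    slot-surjective : ∀ j → ∃ λ i → slot (element i) ≡ j
    slot-surjective = Fin-injective⇒surjective (slot ∘ element)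
      (Injection.injective (↔⇒↣ (↔-sym enum)) ∘ slot-injective)

  sorting : A ↔ Fin N
  sorting = mk↔ₛ′ slot (element ∘ proj₁ ∘ slot-surjective) (proj₂ ∘ slot-surjective)
                  (λ x → slot-injective (proj₂ (slot-surjective (slot x))))

  sorting-mono-< : ∀ {x y} → κ x < κ y → pos sorting x < pos sorting y
  sorting-mono-< {x} {y} = subst₂ _<_ (sym (toℕ-slot x)) (sym (toℕ-slot y)) ∘ rank-mono-<

  sorting-cancel-< : ∀ {x y} → pos sorting x < pos sorting y → κ x < κ y
  sorting-cancel-< {x} {y} = rank-cancel-< ∘ subst₂ _<_ (toℕ-slot x) (toℕ-slot y)

  sorting-cancel-≤ : ∀ {x y} → pos sorting x ≤ pos sorting y → κ x ≤ κ y
  sorting-cancel-≤ px≤py = ≮⇒≥ (λ κy<κx → <⇒≱ (sorting-mono-< κy<κx) px≤py)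

module _ {M : ℕ} where

  lex-< : ∀ {x y s t} → x ≤ y → s < t → x * M + s < y * M + t
  lex-< {x} {y} {s} x≤y s<t = ≤-<-trans (+-monoˡ-≤ s (*-monoˡ-≤ M x≤y)) (+-monoʳ-< (y * M) s<t)

  lex-cancel-≤ : ∀ {x y s t} → t < M → x * M + s ≤ y * M + t → x ≤ y
  lex-cancel-≤ {x} {y} {s} {t} t<M xs≤yt = ≮⇒≥ λ y<x → <⇒≱ (begin-strict
    y * M + t  <⟨ +-monoʳ-< (y * M) t<M ⟩
    y * M + M  ≡⟨ +-comm (y * M) M ⟩
    suc y * M  ≤⟨ *-monoˡ-≤ M y<x ⟩
    x * M      ≤⟨ m≤m+n (x * M) s ⟩
    x * M + s  ∎) xs≤yt
    where open ≤-Reasoning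

  lex-injective : ∀ {x y s t} → s < M → t < M → x * M + s ≡ y * M + t → x ≡ y × s ≡ t
  lex-injective {x} {y} {s} {t} s<M t<M eq
    with ≤-antisym (lex-cancel-≤ {x} {y} t<M (≤-reflexive eq))
                   (lex-cancel-≤ {y} {x} s<M (≤-reflexive (sym eq)))
  ... | refl = refl , +-cancelˡ-≡ (x * M) s t eq

Separates : ℕ → ℕ → ℕ → Bool
Separates a b i = ((a <ᵇ i) ∧ (i ≤ᵇ b)) ∨ ((b <ᵇ i) ∧ (i ≤ᵇ a))

⊓≤-< : ∀ {a b q} → a ⊓ b ≤ q → q < b → a ≤ q
⊓≤-< {a} {b} a⊓b≤q q<b with ≤-total a b
... | inj₁ a≤b = subst (_≤ _) (m≤n⇒m⊓n≡m a≤b) a⊓b≤q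
... | inj₂ b≤a = contradiction (subst (_≤ _) (m≥n⇒m⊓n≡n b≤a) a⊓b≤q) (<⇒≱ q<b)

separates-<ʳ : ∀ {a b q} → a ⊓ b ≤ q → q < b → T (Separates a b (suc q))
separates-<ʳ a⊓b≤q q<b = Equivalence.from T-∨ (inj₁ (Equivalence.from T-∧
  (<⇒<ᵇ (s≤s (⊓≤-< a⊓b≤q q<b)) , ≤⇒≤ᵇ q<b)))

separates-<ˡ : ∀ {a b q} → a ⊓ b ≤ q → q < a → T (Separates a b (suc q))
separates-<ˡ {a} {b} a⊓b≤q q<a = Equivalence.from T-∨ (inj₂ (Equivalence.from T-∧
  (<⇒<ᵇ (s≤s (⊓≤-< (subst (_≤ _) (⊓-comm a b) a⊓b≤q) q<a)) , ≤⇒≤ᵇ q<a)))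

-- a and b are the positions of the ends of an edge, q the position of the
-- anchor of the node after which D is cut, and cᵢ says that the arc into the
-- end at a (resp. b) crosses; it may do so with q at that end only if x.
arcs-crossing-≤ : ∀ {a b q} {c₁ c₂ x : Bool} → a ≢ b →
  (T c₁ → a ⊓ b ≤ q × (q < a ⊎ q ≡ a × T x)) →
  (T c₂ → a ⊓ b ≤ q × (q < b ⊎ q ≡ b × T x)) →
  ind c₁ + ind c₂ ≤ ind (Separates a b (suc q)) + ind x
arcs-crossing-≤ {a} {b} {q} {c₁} {c₂} {x} a≢b cross₁ cross₂ =
  ind-+-≤ (one separates-<ˡ ∘ cross₁) (one separates-<ʳ ∘ cross₂) both
  where
  one : ∀ {c} → (a ⊓ b ≤ q → q < c → T (Separates a b (suc q))) →
        a ⊓ b ≤ q × (q < c ⊎ q ≡ c × T x) → T (Separates a b (suc q)) ⊎ T x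
  one separates (a⊓b≤q , inj₁ q<c)       = inj₁ (separates a⊓b≤q q<c)
  one _         (_     , inj₂ (_ , tx)) = inj₂ tx

  both : T c₁ → T c₂ → T (Separates a b (suc q)) × T x
  both t₁ t₂ with cross₁ t₁ | cross₂ t₂
  ... | a⊓b≤q , inj₁ q<a         | _     , inj₁ q<b         = contradiction a⊓b≤q (<⇒≱ (⊓-glb q<a q<b))
  ... | a⊓b≤q , inj₁ q<a         | _     , inj₂ (_ , tx)    = separates-<ˡ a⊓b≤q q<a , tx
  ... | a⊓b≤q , inj₂ (_ , tx)    | _     , inj₁ q<b         = separates-<ʳ a⊓b≤q q<b , tx
  ... | _     , inj₂ (q≡a , _)   | _     , inj₂ (q≡b , _)   = contradiction (trans (sym q≡a) q≡b) a≢b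

-- The layout of D induced by a layout of G

module Layout {n m} (G : Graph n m) (π : Fin n ↔ Fin n) where

  P : Fin n → ℕ
  P = pos π

  P-injective : Injective _≡_ _≡_ P
  P-injective = Injection.injective (↔⇒↣ π) ∘ toℕ-injective

  end₁ end₂ : Fin m → Fin n
  end₁ e = proj₁ (ends G e)
  end₂ e = proj₂ (ends G e)

  ends-differ : ∀ e → P (end₁ e) ≢ P (end₂ e)
  ends-differ e = noLoop G e ∘ P-injective

  incident-end₁ : ∀ {w} e → w ≡ end₁ e → T (incident G w e)
  incident-end₁ {w} e w≡a = Equivalence.from (T-∨ {⌊ w ≟ end₁ e ⌋}) (inj₁ (fromWitness w≡a))

  incident-end₂ : ∀ {w} e → w ≡ end₂ e → T (incident G w e)
  incident-end₂ {w} e w≡b = Equivalence.from (T-∨ {⌊ w ≟ end₁ e ⌋}) (inj₂ (fromWitness w≡b))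

  owner : Fin m → Fin n
  owner e = if P (end₁ e) ≤ᵇ P (end₂ e) then end₁ e else end₂ e

  P-owner : ∀ e → P (owner e) ≡ P (end₁ e) ⊓ P (end₂ e)
  P-owner e with P (end₁ e) ≤ᵇ P (end₂ e) in a≤ᵇb
  ... | true  = sym (m≤n⇒m⊓n≡m (≤ᵇ⇒≤ _ _ (subst T (sym a≤ᵇb) _)))
  ... | false = sym (m≥n⇒m⊓n≡n (≰⇒≥ (λ a≤b → subst T a≤ᵇb (≤⇒≤ᵇ a≤b))))

  owner-incident : ∀ e → T (incident G (owner e) e)
  owner-incident e with P (end₁ e) ≤ᵇ P (end₂ e)
  ... | true  = incident-end₁ e refl
  ... | false = incident-end₂ e refl

  Node : Set
  Node = Fin n ⊎ Fin m

  anchor : Node → Fin n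
  anchor (inj₁ v) = v
  anchor (inj₂ e) = owner e

  offset : Node → ℕ
  offset (inj₁ _) = m
  offset (inj₂ e) = toℕ e

  offset<1+m : ∀ z → offset z < suc m
  offset<1+m (inj₁ _) = ≤-refl
  offset<1+m (inj₂ e) = m<n⇒m<1+n (toℕ<n e)

  -- Sorting by this key lists the vertices in the order π, each vertex
  -- immediately preceded by the edges it owns.
  key : Node → ℕ
  key z = P (anchor z) * suc m + offset z

  key-injective : Injective _≡_ _≡_ key
  key-injective {x} {y} eq = same-node x y (lex-injective (offset<1+m x) (offset<1+m y) eq)
    where
    same-node : ∀ x y → P (anchor x) ≡ P (anchor y) × offset x ≡ offset y → x ≡ y
    same-node (inj₁ u) (inj₁ v) (Pu≡Pv , _) = cong inj₁ (P-injective Pu≡Pv)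
    same-node (inj₂ e) (inj₂ f) (_ , e≡f)   = cong inj₂ (toℕ-injective e≡f)
    same-node (inj₁ u) (inj₂ f) (_ , m≡f)   = contradiction (toℕ<n f) (<-irrefl (sym m≡f))
    same-node (inj₂ e) (inj₁ v) (_ , e≡m)   = contradiction (toℕ<n e) (<-irrefl e≡m)

  open Sorting (↔-sym (+↔⊎ {n} {m})) key key-injective

  σ : DOrd n m
  σ = sorting

  edge-precedes : ∀ e {a} → P (owner e) ≤ P a → pos σ (inj₂ e) < pos σ (inj₁ a)
  edge-precedes e {a} owner≤a = sorting-mono-< {inj₂ e} {inj₁ a} (lex-< {suc m} owner≤a (toℕ<n e))

  topological : Topological G σ
  topological e = edge-precedes e (subst (_≤ P (end₁ e)) (sym (P-owner e)) (m⊓n≤m _ _))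
                , edge-precedes e (subst (_≤ P (end₂ e)) (sym (P-owner e)) (m⊓n≤n _ _))

  -- After an edge node, arcs into its anchor may cross the cut of D
  -- although their edge does not cross the cut of G.
  extra : Node → Fin m → Bool
  extra (inj₁ _) _ = false
  extra (inj₂ f)   = incident G (owner f)

  key<vertex⇒anchor≤ : ∀ z {a e} → (∀ {w} → w ≡ a → T (incident G w e)) →
    key z < key (inj₁ a) → P (anchor z) < P a ⊎ P (anchor z) ≡ P a × T (extra z e)
  key<vertex⇒anchor≤ (inj₁ v) _ v<a = inj₁ (*-cancelʳ-< (suc m) _ _ (+-cancelʳ-< m _ _ v<a))
  key<vertex⇒anchor≤ (inj₂ f) incident-a f<a
    with m≤n⇒m<n∨m≡n (lex-cancel-≤ {suc m} ≤-refl (<⇒≤ f<a))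
  ... | inj₁ owner<a = inj₁ owner<a
  ... | inj₂ owner≡a = inj₂ (owner≡a , incident-a (P-injective owner≡a))

  arc-crosses : ∀ z e {a} → (∀ {w} → w ≡ a → T (incident G w e)) →
    T ((pos σ (inj₂ e) <ᵇ suc (pos σ z)) ∧ (suc (pos σ z) ≤ᵇ pos σ (inj₁ a))) →
    P (end₁ e) ⊓ P (end₂ e) ≤ P (anchor z) × (P (anchor z) < P a ⊎ P (anchor z) ≡ P a × T (extra z e))
  arc-crosses z e {a} incident-a crosses with Equivalence.to T-∧ crosses
  ... | e-before , a-after =
    subst (_≤ P (anchor z)) (P-owner e)
      (lex-cancel-≤ {suc m} (offset<1+m z) (sorting-cancel-≤ {inj₂ e} {z} (s≤s⁻¹ (<ᵇ⇒< _ _ e-before)))) ,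
    key<vertex⇒anchor≤ z incident-a (sorting-cancel-< {z} {inj₁ a} (≤ᵇ⇒≤ _ _ a-after))

  cutAfter : Node → ℕ
  cutAfter z = cutD G σ (suc (pos σ z))

  cutAfter≤ : ∀ z → cutAfter z ≤ cutG G π (suc (P (anchor z))) + count (extra z)
  cutAfter≤ z = count-+-mono λ e →
    arcs-crossing-≤ (ends-differ e) (arc-crosses z e (incident-end₁ e)) (arc-crosses z e (incident-end₂ e))

  cutGAfter : Fin n → ℕ
  cutGAfter v = cutG G π (suc (P v))

  cutAfter-vertex≤ : ∀ v → cutAfter (inj₁ v) ≤ cutGAfter v
  cutAfter-vertex≤ v = subst (cutAfter (inj₁ v) ≤_)
    (trans (cong (cutGAfter v +_) (count-false m)) (+-identityʳ (cutGAfter v))) (cutAfter≤ (inj₁ v))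

  costΣ≡sum-cutGAfter : costΣ G π ≡ sum cutGAfter
  costΣ≡sum-cutGAfter = trans (sumTo≡sum (cutG G π) n) (sum-permute _ π)

  costDΣ≡sum-cutAfter : costDΣ G σ ≡ sum (cutAfter ∘ inj₁) + sum (cutAfter ∘ inj₂)
  costDΣ≡sum-cutAfter = trans (sumTo≡sum (cutD G σ) (n + m))
    (trans (sum-permute _ (σ ↔-∘ +↔⊎)) (sum-splitAt n cutAfter))

  module _ {d} (regular : Regular G d) where

    cutAfter-edge≤ : ∀ e → cutAfter (inj₂ e) ≤ cutGAfter (owner e) + d
    cutAfter-edge≤ e =
      subst (cutAfter (inj₂ e) ≤_) (cong (cutGAfter (owner e) +_) (regular (owner e))) (cutAfter≤ (inj₂ e))

    owned-≤ : ∀ v → count (λ e → ⌊ owner e ≟ v ⌋) ≤ d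
    owned-≤ v = subst (_ ≤_) (regular v)
      (count-mono λ e owner≡v → subst (λ w → T (incident G w e)) (toWitness owner≡v) (owner-incident e))

    costDΣ≤ : costDΣ G σ ≤ (costΣ G π + 1 * m) * (d + 1)
    costDΣ≤ = begin
      costDΣ G σ
        ≡⟨ costDΣ≡sum-cutAfter ⟩
      sum (cutAfter ∘ inj₁) + sum (cutAfter ∘ inj₂)
        ≤⟨ +-mono-≤ (sum-mono cutAfter-vertex≤) (sum-mono cutAfter-edge≤) ⟩
      sum cutGAfter + sum (λ e → cutGAfter (owner e) + d)
        ≡⟨ cong (sum cutGAfter +_) (∑-distrib-+ (cutGAfter ∘ owner) (λ _ → d)) ⟩
      sum cutGAfter + (sum (cutGAfter ∘ owner) + sum {m} (λ _ → d))
        ≡⟨ cong (λ s → sum cutGAfter + (sum (cutGAfter ∘ owner) + s)) (sum-const m d) ⟩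
      sum cutGAfter + (sum (cutGAfter ∘ owner) + m * d)
        ≤⟨ +-monoʳ-≤ (sum cutGAfter) (+-monoˡ-≤ (m * d) (sum-fibres-≤ d owner cutGAfter owned-≤)) ⟩
      sum cutGAfter + (d * sum cutGAfter + m * d)
        ≡⟨ cong (λ K → K + (d * K + m * d)) costΣ≡sum-cutGAfter ⟨
      costΣ G π + (d * costΣ G π + m * d)
        ≤⟨ m≤m+n _ m ⟩
      costΣ G π + (d * costΣ G π + m * d) + m
        ≡⟨ expand (costΣ G π) d m ⟩
      (costΣ G π + 1 * m) * (d + 1)
        ∎
      where
      open ≤-Reasoning
      expand : ∀ K d m → K + (d * K + m * d) + m ≡ (K + 1 * m) * (d + 1)
      expand = solve-∀

    costDMax≤ : costDMax G σ ≤ costMax G π + d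
    costDMax≤ = maxTo-lub (cutD G σ) (n + m) λ j j<n+m →
      subst (λ i → cutD G σ (suc i) ≤ costMax G π + d) (position-of j<n+m)
            (cutAfter-max≤ (Inverse.from σ (fromℕ< j<n+m)))
      where
      position-of : ∀ {j} (j<n+m : j < n + m) → pos σ (Inverse.from σ (fromℕ< j<n+m)) ≡ j
      position-of j<n+m = trans (cong toℕ (Inverse.strictlyInverseˡ σ _)) (toℕ-fromℕ< j<n+m)
      cutGAfter≤costMax : ∀ v → cutGAfter v ≤ costMax G π
      cutGAfter≤costMax v = ≤-maxTo (cutG G π) n (toℕ<n (Inverse.to π v))
      cutAfter-max≤ : ∀ z → cutAfter z ≤ costMax G π + d
      cutAfter-max≤ (inj₁ v) = ≤-trans (cutAfter-vertex≤ v) (≤-trans (cutGAfter≤costMax v) (m≤m+n _ d))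
      cutAfter-max≤ (inj₂ e) = ≤-trans (cutAfter-edge≤ e) (+-monoˡ-≤ d (cutGAfter≤costMax (owner e)))

lemma4p2 : ∃ λ (C : ℕ) → ∀ {n m} (G : Graph n m) (d : ℕ) → Regular G d →
    (∀ k k′ → IsMLA G k → IsLayoutΣ G k′ → k′ ≤ (k + C * m) * (d + 1)) ×
    (∀ k k′ → IsMCLA G k → IsLayoutMax G k′ → k′ ≤ k + d)
lemma4p2 = 1 , λ {_} {m} G d regular →
  (λ { k k′ ((π , _ , costΣ≡k) , _) (_ , k′-minimal) →
         let open Layout G π in
         ≤-trans (k′-minimal σ topological)
                 (subst (λ K → costDΣ G σ ≤ (K + 1 * m) * (d + 1)) costΣ≡k (costDΣ≤ regular)) }) ,
  (λ { k k′ ((π , _ , costMax≡k) , _) (_ , k′-minimal) →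
         let open Layout G π in
         ≤-trans (k′-minimal σ topological)
                 (subst (λ K → costDMax G σ ≤ K + d) costMax≡k (costDMax≤ regular)) })
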